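{- Let $z^*$ be the item requested in some step and let $x,y$ be items with $y\prec x$, $x\neq z^*$, $y\neq z^*$. Then the state of the pair $\{x,y\}$ changes during the step as follows: $\alpha^d\to\alpha^d$; $\beta^d\to\beta^d$; $\alpha^{oe}\to\alpha^{oe}$; $\beta^o\to$ $\beta^o$ or $\beta^{ne}$; $\beta^{ne}\to\beta^{ne}$; $\gamma^{ne}\to\gamma^{ne}$.
   Context: List Update (uniform, partial cost model): accessing position $\ell$ costs $\ell-1$; adjacent swaps cost $1$. $a\prec b$ means $a$ is before $b$ in FPM's current list; $\preceq$ allows equality. For a pair $\{x,y\}$, $\sigma_{xy}$ is the subsequence of requests to $x$ or $y$; after each prefix of the input, $W^{xy}(xy)$ (resp. $W^{xy}(yx)$) is the minimum cost of serving the corresponding prefix of $\sigma_{xy}$ on a two-item list $\{x,y\}$ starting from their initial relative order and ending in configuration $xy$ (resp. $yx$). Mode of $\{x,y\}$ with $y\prec x$: $\alpha$ if $W^{xy}(yx)+1=W^{xy}(xy)$; $\beta$ if equal; $\gamma$ if $W^{xy}(yx)-1=W^{xy}(xy)$. FPM keeps targets $\theta_x$ (initially $\theta_x=x$). On a request to $z^*$: (1) every $y\neq z^*$ with $\theta_y=z^*$ gets $\theta_y:=$ successor of $z^*$; (2) partial move (insert $z^*$ immediately before $\theta_{z^*}$) or full move (move $z^*$ to front); (3) $\theta_{z^*}:=$ front item. Flavor of $\{x,y\}$ with $y\prec x$: $d$ if $\theta_y\preceq y\prec\theta_x\preceq x$; $o$ if $\theta_y\prec\theta_x\preceq y\prec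 x$; $e$ if $\theta_y=\theta_x\preceq y\prec x$; $n$ if $\theta_x\prec\theta_y\preceq y\prec x$. The state is $\xi^\omega$ (mode $\xi$, flavor $\omega$); $\alpha^{oe}$ means "$\alpha^o$ or $\alpha^e$", $\beta^{ne}$ means "$\beta^n$ or $\beta^e$", $\gamma^{ne}$ means "$\gamma^n$ or $\gamma^e$". -}

module Defs where

open import Data.Nat using (ℕ; zero; suc; _+_; _<_; _⊓_; _<ᵇ_)
open import Data.Fin using (Fin; _≟_)
open import Data.Bool using (Bool; true; false; if_then_else_)
open import Data.Maybe using (Maybe; just; nothing)
open import Data.List using (List; []; _∷_; foldl)
open import Data.Product using (_×_; _,_; proj₁)
open import Data.Sum using (_⊎_)
open import Relation.Nullary using (yes; no; does)
open import Relation.Binary.PropositionalEquality using (_≡_)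

module _ {n : ℕ} where

  -- position (0-based) of the first occurrence of a in L
  -- (length L if a does not occur; never happens for the lists below)
  pos : List (Fin n) → Fin n → ℕ
  pos []      a = 0
  pos (c ∷ L) a with c ≟ a
  ... | yes _ = 0
  ... | no  _ = suc (pos L a)

  _≺[_]_ : Fin n → List (Fin n) → Fin n → Set
  a ≺[ L ] b = pos L a < pos L b

  _⪯[_]_ : Fin n → List (Fin n) → Fin n → Set
  a ⪯[ L ] b = (a ≡ b) ⊎ (a ≺[ L ] b)

  -- Two-item work function W^{ab}, partial cost model.
  -- A configuration of the two-item list {a,b} is a Bool:
  --   true  = a before b,  false = b before a.

  swapCost : Bool → Bool → ℕ
  swapCost true  true  = 0
  swapCost false false = 0
  swapCost true  false = 1
  swapCost false true  = 1

  accCost : (a b r : Fin n) → Bool → ℕ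
  accCost a b r true  with a ≟ r
  ... | yes _ = 0
  ... | no  _ = 1
  accCost a b r false with b ≟ r
  ... | yes _ = 0
  ... | no  _ = 1

  -- one request of the input: requests to items outside {a,b} are not
  -- part of σ_ab and leave W unchanged; for r ∈ {a,b}:
  -- W'(c) = min over c₁ c₂ of  W(c₁) + swap(c₁,c₂) + acc(c₂,r) + swap(c₂,c)
  wStep : (a b : Fin n) → (Bool → ℕ) → Fin n → (Bool → ℕ)
  wStep a b w r c with does (r ≟ a) Data.Bool.∨ does (r ≟ b)
  ... | false = w c
  ... | true  =
      (term true true ⊓ term true false) ⊓ (term false true ⊓ term false false)
    where
    term : Bool → Bool → ℕ
    term c₁ c₂ = w c₁ + swapCost c₁ c₂ + accCost a b r c₂ + swapCost c₂ c

  W : (L0 σ : List (Fin n)) → (a b : Fin n) → Bool → ℕ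
  W L0 σ a b = foldl (wStep a b) (λ c → swapCost (pos L0 a <ᵇ pos L0 b) c) σ

  record State : Set where
    constructor ⟨_,_⟩
    field
      list : List (Fin n)
      θ    : Fin n → Fin n
  open State public

  succOf : List (Fin n) → Fin n → Maybe (Fin n)
  succOf []      z = nothing
  succOf (c ∷ L) z with c ≟ z
  ... | yes _ = Data.List.head L
  ... | no  _ = succOf L z

  delete : Fin n → List (Fin n) → List (Fin n)
  delete z []      = []
  delete z (c ∷ L) with c ≟ z
  ... | yes _ = L
  ... | no  _ = c ∷ delete z L

  insertBefore : Fin n → Fin n → List (Fin n) → List (Fin n)
  insertBefore t z []      = z ∷ []
  insertBefore t z (c ∷ L) with c ≟ t
  ... | yes _ = z ∷ c ∷ L
  ... | no  _ = c ∷ insertBefore t z L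

  fromMaybe : Fin n → Maybe (Fin n) → Fin n
  fromMaybe d nothing  = d
  fromMaybe d (just v) = v

  headOr : Fin n → List (Fin n) → Fin n
  headOr d []      = d
  headOr d (c ∷ _) = c

  -- step (1): every y ≠ z with θ_y = z gets θ_y := successor of z
  retarget : Fin n → List (Fin n) → (Fin n → Fin n) → Fin n → Fin n
  retarget z L θ y with y ≟ z | θ y ≟ z
  ... | no _ | yes _ = fromMaybe (θ y) (succOf L z)
  ... | _    | _     = θ y

  -- step (2): full = true: move z to front;
  --           full = false: insert z immediately before θ_z
  moveStep : Bool → Fin n → Fin n → List (Fin n) → List (Fin n)
  moveStep true  z t L = z ∷ delete z L
  moveStep false z t L with t ≟ z
  ... | yes _ = L
  ... | no  _ = insertBefore t z (delete z L)

  -- step (3): θ_z := front item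
  setTarget : Fin n → Fin n → (Fin n → Fin n) → Fin n → Fin n
  setTarget z f θ y with y ≟ z
  ... | yes _ = f
  ... | no  _ = θ y

  step : Fin n → Bool → State → State
  step z full ⟨ L , θ ⟩ =
    let θ₁ = retarget z L θ
        L′ = moveStep full z (θ₁ z) L
    in ⟨ L′ , setTarget z (headOr z L′) θ₁ ⟩

  initState : List (Fin n) → State
  initState L0 = ⟨ L0 , (λ x → x) ⟩

  run : List (Fin n) → List (Fin n × Bool) → State
  run L0 hist = foldl (λ S p → step (proj₁ p) (Data.Product.proj₂ p) S) (initState L0) hist

  data Mode : Set where α β γ : Mode

  -- HasMode ξ (W^{xy}(yx)) (W^{xy}(xy))
  HasMode : Mode → ℕ → ℕ → Set
  HasMode α wyx wxy = wyx + 1 ≡ wxy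
  HasMode β wyx wxy = wyx ≡ wxy
  HasMode γ wyx wxy = wyx ≡ wxy + 1

  data Flavor : Set where d o e nf : Flavor   -- nf is flavor "n"

  HasFlavor : Flavor → State → (x y : Fin n) → Set
  HasFlavor d  S x y = let L = list S ; θ = State.θ S in
    (θ y ⪯[ L ] y) × (y ≺[ L ] θ x) × (θ x ⪯[ L ] x)
  HasFlavor o  S x y = let L = list S ; θ = State.θ S in
    (θ y ≺[ L ] θ x) × (θ x ⪯[ L ] y) × (y ≺[ L ] x)
  HasFlavor e  S x y = let L = list S ; θ = State.θ S in
    (θ y ≡ θ x) × (θ x ⪯[ L ] y) × (y ≺[ L ] x)
  HasFlavor nf S x y = let L = list S ; θ = State.θ S in
    (θ x ≺[ L ] θ y) × (θ y ⪯[ L ] y) × (y ≺[ L ] x)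

  InState : Mode → Flavor → (L0 σ : List (Fin n)) → State → (x y : Fin n) → Set
  InState ξ ω L0 σ S x y =
    HasMode ξ (W L0 σ y x true) (W L0 σ y x false) × HasFlavor ω S x y

{-# OPTIONS --safe #-}
-- The request to z is not part of σ_xy, so W^{xy} and with it the mode of {x,y} do not
-- change. On targets, step (1) acts through the map advance z L that replaces z by its
-- successor (and fixes every other item, in particular x and y); this map is monotone and
-- inflationary for the list order, and under any such map a flavor can only move
-- d → d, o → o/e, e → e, n → n/e. Step (2) moves only z, so it keeps the relative order
-- of all other items, and none of x, y and their new targets is z: a target equal to z
-- lies before x resp. y, so z has a successor. Step (3) only changes θ_z.
module Submission where

open import Defs
open import Data.Nat using (ℕ; suc; z≤n; s≤s; s≤s⁻¹)
open import Data.Nat.Properties using (<-trans; <-irrefl)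
open import Data.Fin using (Fin; _≟_)
open import Data.Bool using (Bool; true; false)
open import Data.Maybe using (just; nothing)
open import Data.Product as Product using (∃; _×_; _,_; proj₁)
open import Data.Sum as Sum using (_⊎_; inj₁; inj₂; [_,_]′)
open import Data.Empty using (⊥-elim)
open import Function using (_∘_)
open import Data.List using (List; []; _∷_; _++_; map; foldl)
open import Data.List.Properties using (foldl-∷ʳ)
open import Data.List.Membership.Propositional using (_∈_)
open import Data.List.Relation.Unary.All as All using (_∷_)
open import Data.List.Relation.Unary.AllPairs using (_∷_)
open import Data.List.Relation.Unary.Any using (here; there)
open import Data.List.Relation.Unary.Unique.Propositional using (Unique)
open import Data.List.Relation.Binary.Permutation.Propositional
  using (_↭_; ↭-refl; ↭-prep; ↭-swap; ↭-trans; ↭-sym; ↭⇒↭ₛ)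
open import Data.List.Relation.Binary.Permutation.Propositional.Properties using (∈-resp-↭)
import Data.List.Relation.Binary.Permutation.Setoid.Properties as ↭ₛ
open import Relation.Nullary using (yes; no; ¬_)
open import Relation.Binary.PropositionalEquality
  using (_≡_; _≢_; refl; sym; trans; cong; subst₂; ≢-sym; setoid)

module _ {n : ℕ} where

  private variable
    a b c s t u w z : Fin n
    L M : List (Fin n)

  pos-there : a ≢ c → pos (c ∷ L) a ≡ suc (pos L a)
  pos-there {a} {c} a≢c with c ≟ a
  ... | yes c≡a = ⊥-elim (a≢c (sym c≡a))
  ... | no _    = refl

  pos-here : pos (c ∷ L) c ≡ 0
  pos-here {c} with c ≟ c
  ... | yes _   = refl
  ... | no c≢c = ⊥-elim (c≢c refl)

  ≺-irrefl : ¬ a ≺[ L ] a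
  ≺-irrefl = <-irrefl refl

  ≺-trans : a ≺[ L ] b → b ≺[ L ] c → a ≺[ L ] c
  ≺-trans = <-trans

  ⪯-trans : a ⪯[ L ] b → b ⪯[ L ] c → a ⪯[ L ] c
  ⪯-trans (inj₁ refl) b⪯c         = b⪯c
  ⪯-trans (inj₂ a≺b)  (inj₁ refl) = inj₂ a≺b
  ⪯-trans {L = L} (inj₂ a≺b) (inj₂ b≺c) = inj₂ (≺-trans {L = L} a≺b b≺c)

  ≺-⪯-trans : a ≺[ L ] b → b ⪯[ L ] c → a ≺[ L ] c
  ≺-⪯-trans a≺b (inj₁ refl) = a≺b
  ≺-⪯-trans {L = L} a≺b (inj₂ b≺c) = ≺-trans {L = L} a≺b b≺c

  ⪯-≺-trans : a ⪯[ L ] b → b ≺[ L ] c → a ≺[ L ] c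
  ⪯-≺-trans (inj₁ refl) b≺c = b≺c
  ⪯-≺-trans {L = L} (inj₂ a≺b) b≺c = ≺-trans {L = L} a≺b b≺c

  ≺-∷⁺ : a ≢ c → b ≢ c → a ≺[ L ] b → a ≺[ c ∷ L ] b
  ≺-∷⁺ {L = L} a≢c b≢c a≺b rewrite pos-there {L = L} a≢c | pos-there {L = L} b≢c = s≤s a≺b

  ≺-∷⁻ : a ≢ c → b ≢ c → a ≺[ c ∷ L ] b → a ≺[ L ] b
  ≺-∷⁻ {L = L} a≢c b≢c a≺b rewrite pos-there {L = L} a≢c | pos-there {L = L} b≢c = s≤s⁻¹ a≺b

  ≺-map-∷ : (a ≺[ L ] b → a ≺[ M ] b) → a ≺[ c ∷ L ] b → a ≺[ c ∷ M ] b
  ≺-map-∷ {a} {b = b} {c = c} f a≺b with c ≟ a | c ≟ b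
  ... | yes _ | yes _ = a≺b
  ... | yes _ | no _  = s≤s z≤n
  ... | no _  | yes _ with () ← a≺b
  ... | no _  | no _  = s≤s (f (s≤s⁻¹ a≺b))

  succOf-∈ : succOf L z ≡ just s → s ∈ L
  succOf-∈ {L = c ∷ L} {z = z} eq with c ≟ z
  succOf-∈ {L = c ∷ v ∷ L} refl | yes _ = there (here refl)
  succOf-∈ {L = c ∷ L}     eq   | no _  = there (succOf-∈ eq)

  succOf-≺ : Unique L → succOf L z ≡ just s → z ≺[ L ] s
  succOf-≺ {L = c ∷ L} {z = z} (c∉L ∷ _) eq with c ≟ z
  succOf-≺ {L = c ∷ v ∷ L} (c∉L ∷ _) refl | yes refl
    rewrite pos-there {L = v ∷ L} (≢-sym (All.head c∉L)) = s≤s z≤n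
  succOf-≺ {L = c ∷ L} (c∉L ∷ uniq) eq | no _
    rewrite pos-there {L = L} (≢-sym (All.lookup c∉L (succOf-∈ eq))) = s≤s (succOf-≺ uniq eq)

  succOf-⪯ : succOf L z ≡ just s → z ≺[ L ] w → s ⪯[ L ] w
  succOf-⪯ {L = c ∷ L} {z = z} {w = w} eq z≺w with c ≟ w
  ... | yes _ with () ← z≺w
  ... | no _ with c ≟ z
  succOf-⪯ {L = c ∷ v ∷ L} {w = w} refl _ | no _ | yes refl with v ≟ w
  ... | yes v≡w = inj₁ v≡w
  ... | no _ with c ≟ v
  ...   | yes _ = inj₂ (s≤s z≤n)
  ...   | no _ rewrite pos-here {c = v} {L = L} = inj₂ (s≤s (s≤s z≤n))
  succOf-⪯ {L = c ∷ L} {s = s} eq z≺w | no _ | no _ with c ≟ s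
  ... | yes _ = inj₂ (s≤s z≤n)
  ... | no _  = Sum.map₂ s≤s (succOf-⪯ {L = L} eq (s≤s⁻¹ z≺w))

  succOf-just : w ∈ L → z ≺[ L ] w → ∃ λ s → succOf L z ≡ just s
  succOf-just {w = w} {L = c ∷ L} {z = z} w∈ z≺w with c ≟ w
  ... | yes _ with () ← z≺w
  ... | no c≢w with c ≟ z | w∈
  ...   | _      | here w≡c = ⊥-elim (c≢w (sym w≡c))
  succOf-just {L = c ∷ v ∷ L} _ _ | no _ | yes _ | there _ = v , refl
  ...   | no _   | there w∈L = succOf-just w∈L (s≤s⁻¹ z≺w)

  next : List (Fin n) → Fin n → Fin n
  next L z = fromMaybe z (succOf L z)

  ⪯-next : Unique L → z ⪯[ L ] next L z
  ⪯-next {L = L} {z = z} uniq with succOf L z in eq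
  ... | nothing = inj₁ refl
  ... | just s  = inj₂ (succOf-≺ uniq eq)

  next-⪯ : z ≺[ L ] w → next L z ⪯[ L ] w
  next-⪯ {z = z} {L = L} z≺w with succOf L z in eq
  ... | nothing = inj₂ z≺w
  ... | just s  = succOf-⪯ {L = L} eq z≺w

  next-≢ : Unique L → w ∈ L → z ≺[ L ] w → next L z ≢ z
  next-≢ {L = L} uniq w∈L z≺w with succOf-just w∈L z≺w
  ... | s , eq rewrite eq = λ { refl → ≺-irrefl {L = L} (succOf-≺ uniq eq) }

  advance : Fin n → List (Fin n) → Fin n → Fin n
  advance z L t with t ≟ z
  ... | yes _ = next L z
  ... | no _  = t

  advance-fixes : t ≢ z → advance z L t ≡ t
  advance-fixes {t = t} {z = z} t≢z with t ≟ z
  ... | yes t≡z = ⊥-elim (t≢z t≡z)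
  ... | no _    = refl

  ⪯-advance : Unique L → t ⪯[ L ] advance z L t
  ⪯-advance {t = t} {z = z} uniq with t ≟ z
  ... | yes refl = ⪯-next uniq
  ... | no _     = inj₁ refl

  advance-mono-⪯ : Unique L → t ⪯[ L ] u → advance z L t ⪯[ L ] advance z L u
  advance-mono-⪯ _ (inj₁ refl) = inj₁ refl
  advance-mono-⪯ {L = L} {t = t} {u = u} {z = z} uniq (inj₂ t≺u) with t ≟ z | u ≟ z
  ... | yes refl | yes refl = ⊥-elim (≺-irrefl {L = L} t≺u)
  ... | yes refl | no _     = next-⪯ {L = L} t≺u
  ... | no _     | yes refl = inj₂ (≺-⪯-trans {L = L} t≺u (⪯-next uniq))
  ... | no _     | no _     = inj₂ t≺u

  advance-≢ : Unique L → w ∈ L → w ≢ z → t ⪯[ L ] w → advance z L t ≢ z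
  advance-≢ {z = z} {t = t} uniq w∈L w≢z t⪯w with t ≟ z
  ... | no t≢z   = t≢z
  ... | yes refl with t⪯w
  ...   | inj₁ refl = ⊥-elim (w≢z refl)
  ...   | inj₂ z≺w  = next-≢ uniq w∈L z≺w

  retarget≡advance : ∀ z L θ → w ≢ z → retarget z L θ w ≡ advance z L (θ w)
  retarget≡advance {w = w} z L θ w≢z with w ≟ z | θ w ≟ z
  ... | yes w≡z | _        = ⊥-elim (w≢z w≡z)
  ... | no _    | yes θw≡z = cong (λ t → fromMaybe t (succOf L z)) θw≡z
  ... | no _    | no _     = refl

  module Postcompose {L : List (Fin n)} {f : Fin n → Fin n}
           (f-mono : ∀ {a b} → a ⪯[ L ] b → f a ⪯[ L ] f b) (⪯-f : ∀ {a} → a ⪯[ L ] f a)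
           {θ : Fin n → Fin n} {x y : Fin n} (fx≡x : f x ≡ x) (fy≡y : f y ≡ y) where

    private
      f-⪯ : f w ≡ w → t ⪯[ L ] w → f t ⪯[ L ] w
      f-⪯ {w = w} fw≡w t⪯w = ⪯-trans {L = L} (f-mono t⪯w) (inj₁ fw≡w)

    d⇒d : HasFlavor d ⟨ L , θ ⟩ x y → HasFlavor d ⟨ L , f ∘ θ ⟩ x y
    d⇒d (θy⪯y , y≺θx , θx⪯x) = f-⪯ fy≡y θy⪯y , ≺-⪯-trans {L = L} y≺θx ⪯-f , f-⪯ fx≡x θx⪯x

    o⇒o⊎e : HasFlavor o ⟨ L , θ ⟩ x y → HasFlavor o ⟨ L , f ∘ θ ⟩ x y ⊎ HasFlavor e ⟨ L , f ∘ θ ⟩ x y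
    o⇒o⊎e (θy≺θx , θx⪯y , y≺x) with f-mono (inj₂ θy≺θx)
    ... | inj₁ fθy≡fθx = inj₂ (fθy≡fθx , f-⪯ fy≡y θx⪯y , y≺x)
    ... | inj₂ fθy≺fθx = inj₁ (fθy≺fθx , f-⪯ fy≡y θx⪯y , y≺x)

    e⇒e : HasFlavor e ⟨ L , θ ⟩ x y → HasFlavor e ⟨ L , f ∘ θ ⟩ x y
    e⇒e (θy≡θx , θx⪯y , y≺x) = cong f θy≡θx , f-⪯ fy≡y θx⪯y , y≺x

    nf⇒nf⊎e : HasFlavor nf ⟨ L , θ ⟩ x y → HasFlavor nf ⟨ L , f ∘ θ ⟩ x y ⊎ HasFlavor e ⟨ L , f ∘ θ ⟩ x y
    nf⇒nf⊎e (θx≺θy , θy⪯y , y≺x) with f-mono (inj₂ θx≺θy)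
    ... | inj₁ fθx≡fθy = inj₂ (sym fθx≡fθy , ⪯-trans {L = L} (inj₁ fθx≡fθy) (f-⪯ fy≡y θy⪯y) , y≺x)
    ... | inj₂ fθx≺fθy = inj₁ (fθx≺fθy , f-⪯ fy≡y θy⪯y , y≺x)

  HasFlavor-cong : ∀ ω {L θ θ′} {x y : Fin n} → θ′ x ≡ θ x → θ′ y ≡ θ y →
                   HasFlavor ω ⟨ L , θ ⟩ x y → HasFlavor ω ⟨ L , θ′ ⟩ x y
  HasFlavor-cong d  θ′x≡θx θ′y≡θy h rewrite θ′x≡θx | θ′y≡θy = h
  HasFlavor-cong o  θ′x≡θx θ′y≡θy h rewrite θ′x≡θx | θ′y≡θy = h
  HasFlavor-cong e  θ′x≡θx θ′y≡θy h rewrite θ′x≡θx | θ′y≡θy = h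
  HasFlavor-cong nf θ′x≡θx θ′y≡θy h rewrite θ′x≡θx | θ′y≡θy = h

  OrderPreservedExcept : Fin n → List (Fin n) → List (Fin n) → Set
  OrderPreservedExcept z L L′ = ∀ {a b} → a ≢ z → b ≢ z → a ≺[ L ] b → a ≺[ L′ ] b

  module _ {z : Fin n} {L L′ : List (Fin n)} (preserved : OrderPreservedExcept z L L′) where

    ⪯-preserved : a ≢ z → b ≢ z → a ⪯[ L ] b → a ⪯[ L′ ] b
    ⪯-preserved a≢z b≢z (inj₁ a≡b) = inj₁ a≡b
    ⪯-preserved a≢z b≢z (inj₂ a≺b) = inj₂ (preserved a≢z b≢z a≺b)

    HasFlavor-reorder : ∀ ω {θ} {x y : Fin n} → x ≢ z → y ≢ z → θ x ≢ z → θ y ≢ z →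
                        HasFlavor ω ⟨ L , θ ⟩ x y → HasFlavor ω ⟨ L′ , θ ⟩ x y
    HasFlavor-reorder d  x≢z y≢z θx≢z θy≢z (θy⪯y , y≺θx , θx⪯x) =
      ⪯-preserved θy≢z y≢z θy⪯y , preserved y≢z θx≢z y≺θx , ⪯-preserved θx≢z x≢z θx⪯x
    HasFlavor-reorder o  x≢z y≢z θx≢z θy≢z (θy≺θx , θx⪯y , y≺x) =
      preserved θy≢z θx≢z θy≺θx , ⪯-preserved θx≢z y≢z θx⪯y , preserved y≢z x≢z y≺x
    HasFlavor-reorder e  x≢z y≢z θx≢z θy≢z (θy≡θx , θx⪯y , y≺x) =
      θy≡θx , ⪯-preserved θx≢z y≢z θx⪯y , preserved y≢z x≢z y≺x
    HasFlavor-reorder nf x≢z y≢z θx≢z θy≢z (θx≺θy , θy⪯y , y≺x) =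
      preserved θx≢z θy≢z θx≺θy , ⪯-preserved θy≢z y≢z θy⪯y , preserved y≢z x≢z y≺x

  delete-preservesOrder : OrderPreservedExcept z L (delete z L)
  delete-preservesOrder {z} {[]} a≢z b≢z ()
  delete-preservesOrder {z} {c ∷ L} a≢z b≢z a≺b with c ≟ z
  ... | yes refl = ≺-∷⁻ a≢z b≢z a≺b
  ... | no _     = ≺-map-∷ (delete-preservesOrder {z} {L} a≢z b≢z) a≺b

  insertBefore-preservesOrder : ∀ t → OrderPreservedExcept z L (insertBefore t z L)
  insertBefore-preservesOrder {z} {[]} t a≢z b≢z ()
  insertBefore-preservesOrder {z} {c ∷ L} t a≢z b≢z a≺b with c ≟ t
  ... | yes _ = ≺-∷⁺ a≢z b≢z a≺b
  ... | no _  = ≺-map-∷ (insertBefore-preservesOrder {z} {L} t a≢z b≢z) a≺b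

  moveStep-preservesOrder : ∀ full t → OrderPreservedExcept z L (moveStep full z t L)
  moveStep-preservesOrder {z} {L} true t a≢z b≢z a≺b =
    ≺-∷⁺ a≢z b≢z (delete-preservesOrder {z} {L} a≢z b≢z a≺b)
  moveStep-preservesOrder {z} {L} false t a≢z b≢z a≺b with t ≟ z
  ... | yes _ = a≺b
  ... | no _  = insertBefore-preservesOrder {z} {delete z L} t a≢z b≢z
                  (delete-preservesOrder {z} {L} a≢z b≢z a≺b)

  delete-↭ : z ∈ L → L ↭ z ∷ delete z L
  delete-↭ {z} {c ∷ L} z∈cL with c ≟ z | z∈cL
  ... | yes refl | _         = ↭-refl
  ... | no c≢z   | here z≡c  = ⊥-elim (c≢z (sym z≡c))
  ... | no _     | there z∈L = ↭-trans (↭-prep c (delete-↭ z∈L)) (↭-swap c z ↭-refl)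

  insertBefore-↭ : ∀ t → insertBefore t z L ↭ z ∷ L
  insertBefore-↭ {L = []}    t = ↭-refl
  insertBefore-↭ {z} {c ∷ L} t with c ≟ t
  ... | yes _ = ↭-refl
  ... | no _  = ↭-trans (↭-prep c (insertBefore-↭ t)) (↭-swap c z ↭-refl)

  moveStep-↭ : ∀ full t → z ∈ L → moveStep full z t L ↭ L
  moveStep-↭ true  t z∈L = ↭-sym (delete-↭ z∈L)
  moveStep-↭ {z} false t z∈L with t ≟ z
  ... | yes _ = ↭-refl
  ... | no _  = ↭-trans (insertBefore-↭ t) (↭-sym (delete-↭ z∈L))

  stepWith : State → Fin n × Bool → State
  stepWith S (z , full) = step z full S

  foldl-stepWith-↭ : ∀ {L0} → (∀ i → i ∈ L0) → ∀ hist S → list S ↭ L0 → list (foldl stepWith S hist) ↭ L0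
  foldl-stepWith-↭ complete []                  S S↭L0 = S↭L0
  foldl-stepWith-↭ complete ((z , full) ∷ hist) S S↭L0 =
    foldl-stepWith-↭ complete hist (step z full S)
      (↭-trans (moveStep-↭ full _ (∈-resp-↭ (↭-sym S↭L0) (complete z))) S↭L0)

  run-↭ : ∀ {L0} → (∀ i → i ∈ L0) → ∀ hist → list (run L0 hist) ↭ L0
  run-↭ complete hist = foldl-stepWith-↭ complete hist _ ↭-refl

  run-Unique : ∀ {L0} → Unique L0 → (∀ i → i ∈ L0) → ∀ hist → Unique (list (run L0 hist))
  run-Unique uniq complete hist =
    ↭ₛ.Unique-resp-↭ (setoid (Fin n)) (↭⇒↭ₛ (↭-sym (run-↭ complete hist))) uniq

  run-complete : ∀ {L0} → (∀ i → i ∈ L0) → ∀ hist i → i ∈ list (run L0 hist)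
  run-complete complete hist i = ∈-resp-↭ (↭-sym (run-↭ complete hist)) (complete i)

  wStep-unrequested : ∀ {a b} w c → z ≢ a → z ≢ b → wStep a b w z c ≡ w c
  wStep-unrequested {z} {a} {b} w c z≢a z≢b with z ≟ a | z ≟ b
  ... | yes z≡a | _       = ⊥-elim (z≢a z≡a)
  ... | no _    | yes z≡b = ⊥-elim (z≢b z≡b)
  ... | no _    | no _    = refl

  W-unrequested : ∀ L0 σ {a b} c → z ≢ a → z ≢ b → W L0 (σ ++ z ∷ []) a b c ≡ W L0 σ a b c
  W-unrequested {z} L0 σ {a} {b} c z≢a z≢b =
    trans (cong (λ w → w c) (foldl-∷ʳ (wStep a b) _ z σ)) (wStep-unrequested _ c z≢a z≢b)

  HasMode-unrequested : ∀ ξ L0 σ {x y} → z ≢ x → z ≢ y →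
    HasMode {n} ξ (W L0 σ y x true) (W L0 σ y x false) →
    HasMode {n} ξ (W L0 (σ ++ z ∷ []) y x true) (W L0 (σ ++ z ∷ []) y x false)
  HasMode-unrequested ξ L0 σ z≢x z≢y = subst₂ (HasMode {n} ξ)
    (sym (W-unrequested L0 σ true z≢y z≢x)) (sym (W-unrequested L0 σ false z≢y z≢x))

  setTarget-≢ : ∀ f θ → w ≢ z → setTarget z f θ w ≡ θ w
  setTarget-≢ {w} {z} f θ w≢z with w ≟ z
  ... | yes w≡z = ⊥-elim (w≢z w≡z)
  ... | no _    = refl

  HasFlavor-targets-⪯ : ∀ ω {S} {x y : Fin n} → HasFlavor ω S x y →
                        θ S x ⪯[ list S ] x × θ S y ⪯[ list S ] y
  HasFlavor-targets-⪯ d  (θy⪯y , _ , θx⪯x) = θx⪯x , θy⪯y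
  HasFlavor-targets-⪯ o  {S} (θy≺θx , θx⪯y , y≺x) =
    inj₂ (⪯-≺-trans {L = list S} θx⪯y y≺x) , inj₂ (≺-⪯-trans {L = list S} θy≺θx θx⪯y)
  HasFlavor-targets-⪯ e  {S} (θy≡θx , θx⪯y , y≺x) =
    inj₂ (⪯-≺-trans {L = list S} θx⪯y y≺x) , ⪯-trans {L = list S} (inj₁ θy≡θx) θx⪯y
  HasFlavor-targets-⪯ nf {S} (θx≺θy , θy⪯y , y≺x) =
    inj₂ (≺-trans {L = list S} θx≺θy (⪯-≺-trans {L = list S} θy⪯y y≺x)) , θy⪯y

  module FPMStep (S : State {n}) (z : Fin n) (full : Bool)
                 (uniq : Unique (list S)) (complete : ∀ i → i ∈ list S)
                 {x y : Fin n} (x≢z : x ≢ z) (y≢z : y ≢ z) where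

    private
      targets-after : w ≢ z → θ (step z full S) w ≡ advance z (list S) (θ S w)
      targets-after w≢z = trans (setTarget-≢ _ _ w≢z) (retarget≡advance z (list S) (θ S) w≢z)

      transfer : ∀ ω ω′ → HasFlavor ω S x y →
                 HasFlavor ω′ ⟨ list S , advance z (list S) ∘ θ S ⟩ x y → HasFlavor ω′ (step z full S) x y
      transfer ω ω′ h h′ with HasFlavor-targets-⪯ ω h
      ... | θx⪯x , θy⪯y =
        HasFlavor-cong ω′ (targets-after x≢z) (targets-after y≢z)
          (HasFlavor-reorder (moveStep-preservesOrder full _) ω′ x≢z y≢z
            (advance-≢ uniq (complete x) x≢z θx⪯x) (advance-≢ uniq (complete y) y≢z θy⪯y) h′)

    open Postcompose {L = list S} {f = advance z (list S)} (advance-mono-⪯ uniq) (⪯-advance uniq) {θ S}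
                     (advance-fixes x≢z) (advance-fixes y≢z)

    step-d⇒d : HasFlavor d S x y → HasFlavor d (step z full S) x y
    step-d⇒d h = transfer d d h (d⇒d h)

    step-o⇒o⊎e : HasFlavor o S x y → HasFlavor o (step z full S) x y ⊎ HasFlavor e (step z full S) x y
    step-o⇒o⊎e h = Sum.map (transfer o o h) (transfer o e h) (o⇒o⊎e h)

    step-e⇒e : HasFlavor e S x y → HasFlavor e (step z full S) x y
    step-e⇒e h = transfer e e h (e⇒e h)

    step-nf⇒nf⊎e : HasFlavor nf S x y → HasFlavor nf (step z full S) x y ⊎ HasFlavor e (step z full S) x y
    step-nf⇒nf⊎e h = Sum.map (transfer nf nf h) (transfer nf e h) (nf⇒nf⊎e h)

lemma4p6 : ∀ {n : ℕ} (L0 : List (Fin n)) → Unique L0 → (∀ i → i ∈ L0) →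
    (hist : List (Fin n × Bool)) (z : Fin n) (full : Bool) (x y : Fin n) →
    x ≢ z → y ≢ z → y ≺[ list (run L0 hist) ] x →
    let S = run L0 hist
        S′ = step z full S
        σ = map proj₁ hist
        σ′ = σ ++ (z ∷ [])
    in (InState α d L0 σ S x y → InState α d L0 σ′ S′ x y)
     × (InState β d L0 σ S x y → InState β d L0 σ′ S′ x y)
     × (InState α o L0 σ S x y ⊎ InState α e L0 σ S x y →
        InState α o L0 σ′ S′ x y ⊎ InState α e L0 σ′ S′ x y)
     × (InState β o L0 σ S x y →
        InState β o L0 σ′ S′ x y ⊎ (InState β nf L0 σ′ S′ x y ⊎ InState β e L0 σ′ S′ x y))
     × (InState β nf L0 σ S x y ⊎ InState β e L0 σ S x y →
        InState β nf L0 σ′ S′ x y ⊎ InState β e L0 σ′ S′ x y)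
     × (InState γ nf L0 σ S x y ⊎ InState γ e L0 σ S x y →
        InState γ nf L0 σ′ S′ x y ⊎ InState γ e L0 σ′ S′ x y)
lemma4p6 L0 uniq complete hist z full x y x≢z y≢z _ =
    keep α d d step-d⇒d
  , keep β d d step-d⇒d
  , [ keep⊎ α o o e step-o⇒o⊎e , inj₂ ∘ keep α e e step-e⇒e ]′
  , Sum.map₂ inj₂ ∘ keep⊎ β o o e step-o⇒o⊎e
  , [ keep⊎ β nf nf e step-nf⇒nf⊎e , inj₂ ∘ keep β e e step-e⇒e ]′
  , [ keep⊎ γ nf nf e step-nf⇒nf⊎e , inj₂ ∘ keep γ e e step-e⇒e ]′
  where
  S = run L0 hist
  S′ = step z full S
  σ = map proj₁ hist
  open FPMStep S z full (run-Unique uniq complete hist) (run-complete complete hist) x≢z y≢z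

  keep : ∀ ξ ω ω′ → (HasFlavor ω S x y → HasFlavor ω′ S′ x y) →
         InState ξ ω L0 σ S x y → InState ξ ω′ L0 (σ ++ z ∷ []) S′ x y
  keep ξ _ _ f = Product.map (HasMode-unrequested ξ L0 σ (≢-sym x≢z) (≢-sym y≢z)) f

  keep⊎ : ∀ ξ ω ω₁ ω₂ → (HasFlavor ω S x y → HasFlavor ω₁ S′ x y ⊎ HasFlavor ω₂ S′ x y) →
          InState ξ ω L0 σ S x y → InState ξ ω₁ L0 (σ ++ z ∷ []) S′ x y ⊎ InState ξ ω₂ L0 (σ ++ z ∷ []) S′ x y
  keep⊎ ξ _ _ _ f (mode , h) = Sum.map (mode′ ,_) (mode′ ,_) (f h)
    where mode′ = HasMode-unrequested ξ L0 σ (≢-sym x≢z) (≢-sym y≢z) mode
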